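{- Let $\mathfrak{plc}_I$ be a tropical plactic algebra with ordered set of generators $\{\mathfrak a_i : i\in I\}$. Then for all generators $\mathfrak a,\mathfrak b,\mathfrak c\in\{\mathfrak a_i : i\in I\}$ the Knuth relations hold: $$\mathfrak a\,\mathfrak c\,\mathfrak b=\mathfrak c\,\mathfrak a\,\mathfrak b\quad\text{if } \mathfrak a\le\mathfrak b<\mathfrak c,\qquad \mathfrak b\,\mathfrak a\,\mathfrak c=\mathfrak b\,\mathfrak c\,\mathfrak a\quad\text{if } \mathfrak a<\mathfrak b\le\mathfrak c .$$ Consequently the multiplicative monoid of $\mathfrak{plc}_I$ satisfies the plactic (Knuth) congruence.
   Context: Let $I\subseteq\mathbb N$ be nonempty. A tropical plactic algebra (troplactic algebra) $\mathfrak{plc}_I$ is a (possibly noncommutative) semiring $(\mathfrak{plc}_I,+,\cdot)$ — $(\mathfrak{plc}_I,+)$ a commutative monoid with identity (zero) $\mathfrak o$, $(\mathfrak{plc}_I,\cdot)$ a monoid with identity $\mathfrak e$, multiplication distributing over addition — which is additively idempotent ($\mathfrak u+\mathfrak u=\mathfrak u$ for all $\mathfrak u$), generated by a totally ordered set of elements $\{\mathfrak a_i: i\in I\}$, and satisfying, for all generators $\mathfrak a\le\mathfrak b\le\mathfrak c$: (TPA1) $\mathfrak a=\mathfrak e+\mathfrak a$; (TPA2) $\mathfrak b\mathfrak a=\mathfrak a+\mathfrak b$ whenever $\mathfrak b>\mathfrak a$; (TPA3) $\mathfrak a(\mathfrak b+\mathfrak c)=\mathfrak a\mathfrak b+\mathfrak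 c$; (TPA4) $(\mathfrak a+\mathfrak b)\mathfrak c=\mathfrak a+\mathfrak b\mathfrak c$. -}

module Defs where

open import Level using (Level; _⊔_; suc)
open import Data.Nat using (ℕ; _≤_; _<_)
open import Data.Product using (Σ)
open import Algebra.Bundles using (Semiring)
open import Relation.Unary using (Pred)

data Generated {c ℓ : Level} (S : Semiring c ℓ) (I : Pred ℕ c)
               (gen : Σ ℕ I → Semiring.Carrier S) :
               Semiring.Carrier S → Set (c ⊔ ℓ) where
  g-gen  : ∀ i → Generated S I gen (gen i)
  g-zero : Generated S I gen (Semiring.0# S)
  g-one  : Generated S I gen (Semiring.1# S)
  g-+    : ∀ {x y} → Generated S I gen x → Generated S I gen y →
           Generated S I gen (Semiring._+_ S x y)
  g-*    : ∀ {x y} → Generated S I gen x → Generated S I gen y →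
           Generated S I gen (Semiring._*_ S x y)
  g-≈    : ∀ {x y} → Semiring._≈_ S x y → Generated S I gen x →
           Generated S I gen y

-- A tropical plactic algebra plc_I: a semiring (zero 𝔬 = 0#, identity 𝔢 = 1#),
-- additively idempotent, generated by the generators 𝔞_i (i ∈ I), which are
-- totally ordered by their index in ℕ, satisfying TPA1–TPA4.
record TroplacticAlgebra {c ℓ : Level} (I : Pred ℕ c) : Set (suc (c ⊔ ℓ)) where
  field
    semiring : Semiring c ℓ
  open Semiring semiring public
  field
    I-nonempty : Σ ℕ I
    gen       : Σ ℕ I → Carrier
    +-idem    : ∀ u → (u + u) ≈ u
    generated : ∀ u → Generated semiring I gen u
  _≤g_ : Σ ℕ I → Σ ℕ I → Set
  a ≤g b = Σ.proj₁ a ≤ Σ.proj₁ b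
  _<g_ : Σ ℕ I → Σ ℕ I → Set
  a <g b = Σ.proj₁ a < Σ.proj₁ b
  field
    TPA1 : ∀ a → gen a ≈ (1# + gen a)
    TPA2 : ∀ a b → a <g b → (gen b * gen a) ≈ (gen a + gen b)
    TPA3 : ∀ a b c → a ≤g b → b ≤g c →
           (gen a * (gen b + gen c)) ≈ ((gen a * gen b) + gen c)
    TPA4 : ∀ a b c → a ≤g b → b ≤g c →
           ((gen a + gen b) * gen c) ≈ (gen a + (gen b * gen c))

module Submission where

open import Defs
open import Level using (Level)
open import Data.Nat using (ℕ)
open import Data.Nat.Properties using (≤-refl; <⇒≤; ≤-<-trans; <-≤-trans)
open import Data.Product using (_×_; _,_)
open import Relation.Unary using (Pred)
import Relation.Binary.Reasoning.Setoid as SetoidReasoning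

-- TPA2 turns a descending product of two generators into their sum, and
-- TPA3/TPA4 (with idempotency) let a generator be absorbed into an adjacent
-- product; each Knuth relation is then a rewrite of both sides to the same
-- sum, ab + c or a + bc.

module KnuthRelations {c ℓ : Level} {I : Pred ℕ c} (P : TroplacticAlgebra {c} {ℓ} I) where

  open TroplacticAlgebra P
  open SetoidReasoning setoid

  *-absorbs-+ʳ : ∀ a b → a ≤g b → (gen a * gen b + gen b) ≈ gen a * gen b
  *-absorbs-+ʳ a b a≤b = begin
    gen a * gen b + gen b   ≈⟨ TPA3 a b b a≤b ≤-refl ⟨
    gen a * (gen b + gen b) ≈⟨ *-cong refl (+-idem _) ⟩
    gen a * gen b           ∎

  *-absorbs-+ˡ : ∀ b c → b ≤g c → (gen b + gen b * gen c) ≈ gen b * gen c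
  *-absorbs-+ˡ b c b≤c = begin
    gen b + gen b * gen c   ≈⟨ TPA4 b b c ≤-refl b≤c ⟨
    (gen b + gen b) * gen c ≈⟨ *-cong (+-idem _) refl ⟩
    gen b * gen c           ∎

  knuth-acb≈cab : ∀ a b c → a ≤g b → b <g c →
                  (gen a * gen c * gen b) ≈ (gen c * gen a * gen b)
  knuth-acb≈cab a b c a≤b b<c = begin
    gen a * gen c * gen b           ≈⟨ *-assoc _ _ _ ⟩
    gen a * (gen c * gen b)         ≈⟨ *-cong refl (TPA2 b c b<c) ⟩
    gen a * (gen b + gen c)         ≈⟨ TPA3 a b c a≤b (<⇒≤ b<c) ⟩
    gen a * gen b + gen c           ≈⟨ +-cong (*-absorbs-+ʳ a b a≤b) refl ⟨
    gen a * gen b + gen b + gen c   ≈⟨ +-assoc _ _ _ ⟩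
    gen a * gen b + (gen b + gen c) ≈⟨ +-cong refl (TPA2 b c b<c) ⟨
    gen a * gen b + gen c * gen b   ≈⟨ distribʳ _ _ _ ⟨
    (gen a + gen c) * gen b         ≈⟨ *-cong (TPA2 a c (≤-<-trans a≤b b<c)) refl ⟨
    gen c * gen a * gen b           ∎

  knuth-bac≈bca : ∀ a b c → a <g b → b ≤g c →
                  (gen b * gen a * gen c) ≈ (gen b * gen c * gen a)
  knuth-bac≈bca a b c a<b b≤c = begin
    gen b * gen a * gen c           ≈⟨ *-cong (TPA2 a b a<b) refl ⟩
    (gen a + gen b) * gen c         ≈⟨ TPA4 a b c (<⇒≤ a<b) b≤c ⟩
    gen a + gen b * gen c           ≈⟨ +-cong refl (*-absorbs-+ˡ b c b≤c) ⟨
    gen a + (gen b + gen b * gen c) ≈⟨ +-assoc _ _ _ ⟨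
    gen a + gen b + gen b * gen c   ≈⟨ +-cong (TPA2 a b a<b) refl ⟨
    gen b * gen a + gen b * gen c   ≈⟨ distribˡ _ _ _ ⟨
    gen b * (gen a + gen c)         ≈⟨ *-cong refl (TPA2 a c (<-≤-trans a<b b≤c)) ⟨
    gen b * (gen c * gen a)         ≈⟨ *-assoc _ _ _ ⟨
    gen b * gen c * gen a           ∎

theorem2p8 : {c ℓ : Level} {I : Pred ℕ c} (P : TroplacticAlgebra {c} {ℓ} I) →
    let open TroplacticAlgebra P in
    (∀ a b c → a ≤g b → b <g c →
      (gen a * gen c * gen b) ≈ (gen c * gen a * gen b))
    × (∀ a b c → a <g b → b ≤g c →
      (gen b * gen a * gen c) ≈ (gen b * gen c * gen a))
theorem2p8 P = knuth-acb≈cab , knuth-bac≈bca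
  where open KnuthRelations P
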